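{- Let $k$ be a fixed positive integer. Then $f_k(n)\sim \frac{1}{k}\binom{n}{2}$ as $n\rightarrow\infty$, i.e. $\lim_{n\to\infty} f_k(n)/\binom{n}{2} = 1/k$.
   Context: Let $n$ and $k$ be positive integers and $F$ an alphabet of size $n$. A sequence $a_1,a_2,\ldots,a_m$ over $F$ is a $k$-radius sequence if for all $x,y\in F$ there exist $i,j\in\{1,\ldots,m\}$ with $a_i=x$, $a_j=y$ and $|i-j|\leq k$. $f_k(n)$ denotes the length of the shortest $n$-ary $k$-radius sequence. -}

module Defs where

open import Data.Nat using (ℕ; zero; suc; _≤_; ∣_-_∣)
open import Data.Fin using (Fin; toℕ)
open import Data.List using (List; length; lookup)
open import Data.Product using (Σ; _×_)
open import Data.Integer using (+_)
open import Data.Rational using (ℚ; _/_; 0ℚ)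
open import Relation.Binary.PropositionalEquality using (_≡_)

IsKRadius : (k n : ℕ) → List (Fin n) → Set
IsKRadius k n a =
  (x y : Fin n) → Σ (Fin (length a)) λ i → Σ (Fin (length a)) λ j →
    (lookup a i ≡ x) × (lookup a j ≡ y) × (∣ toℕ i - toℕ j ∣ ≤ k)

-- m is the length of the shortest n-ary k-radius sequence, i.e. m = f_k(n)
IsShortestKRadiusLength : (k n m : ℕ) → Set
IsShortestKRadiusLength k n m =
  Σ (List (Fin n)) (λ a → IsKRadius k n a × (length a ≡ m))
  × ((a : List (Fin n)) → IsKRadius k n a → m ≤ length a)

-- the rational a / d (with the irrelevant convention a / 0 = 0)
ratio : ℕ → ℕ → ℚ
ratio a zero = 0ℚ
ratio a (suc d) = (+ a) / suc d

module Submission where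

-- In a k-radius sequence of length m over n letters each
-- ordered pair (x, z), z ≠ x, is witnessed by an occurrence i of x and one of 2k offsets
-- locating a nearby z; the pair (i, offset) determines (x, z), so n(n - 1) ≤ 2k·m.
--
-- Let C = 2k + 1.  From a radius sequence on B = b + 1 letters,
-- where every j ≤ k divides b, we build one on C·B letters u + y·B ("u in column y"):
-- C·B blocks i ↦ (g₁ + i(i - 1)/2 mod B, g₂ + i mod C) of length b + 1 + k cover all pairs
-- in different columns (j is invertible mod B because j ∣ b), and C copies of the old
-- sequence cover the pairs inside a column.  Starting from the trivial sequence and
-- iterating L times gives c with 2k·f_k(n)·C^L ≤ (C^L + 4k)(n + c)² for all n.
--
-- Conclusion (RationalBounds, Asymptotics, theorem1).  For ε with denominator T take
-- L = 8T; for large n both bounds place f_k(n)/C(n, 2) in [1/k, 1/k + 1/T).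

module ModularArithmetic where

  open import Data.Nat
  open import Data.Nat.Properties
  open import Data.Nat.DivMod
  open import Data.Nat.Divisibility using (_∣_; divides; n∣m*n)
  open import Data.Product using (Σ; _,_)
  open import Data.List using (_∷_; [])
  open import Data.Nat.Tactic.RingSolver using (solve; solve-∀)
  open import Relation.Binary.PropositionalEquality
  open ≡-Reasoning

  %-absorb-+ˡ : ∀ M .{{_ : NonZero M}} a c → (a % M + c) % M ≡ (a + c) % M
  %-absorb-+ˡ M a c = begin
    (a % M + c) % M          ≡⟨ %-distribˡ-+ (a % M) c M ⟩
    (a % M % M + c % M) % M  ≡⟨ cong (λ z → (z + c % M) % M) (m%n%n≡m%n a M) ⟩
    (a % M + c % M) % M      ≡⟨ %-distribˡ-+ a c M ⟨
    (a + c) % M              ∎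

  %-absorb-*ʳ : ∀ M .{{_ : NonZero M}} a c → (a * (c % M)) % M ≡ (a * c) % M
  %-absorb-*ʳ M a c = begin
    (a * (c % M)) % M            ≡⟨ %-distribˡ-* a (c % M) M ⟩
    (a % M * (c % M % M)) % M    ≡⟨ cong (λ z → (a % M * z) % M) (m%n%n≡m%n c M) ⟩
    (a % M * (c % M)) % M        ≡⟨ %-distribˡ-* a c M ⟨
    (a * c) % M                  ∎

  %-cong-+ : ∀ M .{{_ : NonZero M}} a a' c → a % M ≡ a' % M → (a + c) % M ≡ (a' + c) % M
  %-cong-+ M a a' c e = begin
    (a + c) % M        ≡⟨ %-absorb-+ˡ M a c ⟨
    (a % M + c) % M    ≡⟨ cong (λ z → (z + c) % M) e ⟩
    (a' % M + c) % M   ≡⟨ %-absorb-+ˡ M a' c ⟩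
    (a' + c) % M       ∎

  minus-mod : (M : ℕ) → .{{_ : NonZero M}} → ℕ → ℕ → ℕ
  minus-mod M x c = (x + (M ∸ c % M)) % M

  minus-mod-< : ∀ M .{{_ : NonZero M}} x c → minus-mod M x c < M
  minus-mod-< M x c = m%n<n _ M

  minus-mod-spec : ∀ M .{{_ : NonZero M}} x c → (minus-mod M x c + c) % M ≡ x % M
  minus-mod-spec M x c = begin
    ((x + (M ∸ c % M)) % M + c) % M               ≡⟨ %-absorb-+ˡ M (x + (M ∸ c % M)) c ⟩
    (x + (M ∸ c % M) + c) % M                     ≡⟨ cong (λ z → (x + (M ∸ c % M) + z) % M) (m≡m%n+[m/n]*n c M) ⟩
    (x + (M ∸ c % M) + (c % M + c / M * M)) % M   ≡⟨ cong (_% M) regroup ⟩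
    (x + M + c / M * M) % M                       ≡⟨ [m+kn]%n≡m%n (x + M) (c / M) M ⟩
    (x + M) % M                                   ≡⟨ [m+n]%n≡m%n x M ⟩
    x % M                                         ∎
    where
    regroup : x + (M ∸ c % M) + (c % M + c / M * M) ≡ x + M + c / M * M
    regroup = begin
      x + (M ∸ c % M) + (c % M + c / M * M)   ≡⟨ +-assoc (x + (M ∸ c % M)) (c % M) _ ⟨
      x + (M ∸ c % M) + c % M + c / M * M     ≡⟨ cong (_+ c / M * M) (+-assoc x (M ∸ c % M) (c % M)) ⟩
      x + (M ∸ c % M + c % M) + c / M * M     ≡⟨ cong (λ z → x + z + c / M * M) (m∸n+n≡m (m%n≤n c M)) ⟩
      x + M + c / M * M                       ∎

  -- A positive divisor j of b is invertible modulo b + 1: with b = q·j the inverse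
  -- is 1 + q·(j - 1), since j·(1 + q·(j - 1)) = 1 + (j - 1)·(b + 1).
  invertible-mod : ∀ {j b} → 1 ≤ j → j ∣ b →
    Σ ℕ λ v → ∀ R → (j * (v * R)) % suc b ≡ R % suc b
  invertible-mod {suc j'} {.(q * suc j')} _ (divides q refl) = suc (q * j') , inverse
    where
    inverse : ∀ R → (suc j' * (suc (q * j') * R)) % suc (q * suc j') ≡ R % suc (q * suc j')
    inverse R = begin
      (suc j' * (suc (q * j') * R)) % suc (q * suc j')      ≡⟨ cong (_% suc (q * suc j')) expand ⟩
      (R + (j' * R) * suc (q * suc j')) % suc (q * suc j')  ≡⟨ [m+kn]%n≡m%n R (j' * R) (suc (q * suc j')) ⟩
      R % suc (q * suc j')                                  ∎
      where
      expand : suc j' * (suc (q * j') * R) ≡ R + (j' * R) * suc (q * suc j')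
      expand = solve (j' ∷ q ∷ R ∷ [])

  +*-%-digit : ∀ L .{{_ : NonZero L}} g i → i < L → (i + g * L) % L ≡ i
  +*-%-digit L g i i<L = trans ([m+kn]%n≡m%n i g L) (m<n⇒m%n≡m i<L)

  +*-/-digit : ∀ L .{{_ : NonZero L}} g i → i < L → (i + g * L) / L ≡ g
  +*-/-digit L g i i<L = begin
    (i + g * L) / L      ≡⟨ +-distrib-/-∣ʳ i (n∣m*n g) ⟩
    i / L + g * L / L    ≡⟨ cong₂ _+_ (m<n⇒m/n≡0 i<L) (m*n/n≡m g L) ⟩
    g                    ∎

  T : ℕ → ℕ
  T zero = 0
  T (suc i) = T i + i

  T-+ : ∀ a j → T (a + j) ≡ T a + (j * a + T j)
  T-+ a zero rewrite +-identityʳ a | +-identityʳ (T a) = refl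
  T-+ a (suc j) rewrite +-suc a j | T-+ a j = regroup (T a) a j (T j)
    where
    regroup : ∀ ta a j tj → ta + (j * a + tj) + (a + j) ≡ ta + (suc j * a + (tj + j))
    regroup = solve-∀

module Covering where

  open import Data.Nat
  open import Data.Nat.Properties
  open import Data.Nat.DivMod using (_/_; _%_)
  open import Data.Product using (Σ; _×_; _,_)
  open import Data.Sum using (_⊎_; inj₁; inj₂)
  open import Data.Bool using (true; false; if_then_else_)
  open import Data.Empty using (⊥-elim)
  open import Relation.Binary.PropositionalEquality
  open ModularArithmetic using (+*-%-digit; +*-/-digit)

  -- Sequences are functions s : ℕ → ℕ of which the first m entries are used.
  -- Covers k s m x y: the letters x and y occur, in some order, at two positions
  -- i and i + d < m with d ≤ k.
  Covers : ℕ → (ℕ → ℕ) → ℕ → ℕ → ℕ → Set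
  Covers k s m x y = Σ ℕ λ i → Σ ℕ λ d → d ≤ k × i + d < m ×
    ((s i ≡ x × s (i + d) ≡ y) ⊎ (s i ≡ y × s (i + d) ≡ x))

  IsRadiusSeq : ℕ → ℕ → ℕ → (ℕ → ℕ) → Set
  IsRadiusSeq k n m s = ∀ x y → x < n → y < n → Covers k s m x y

  covers-sym : ∀ {k s m x y} → Covers k s m x y → Covers k s m y x
  covers-sym (i , d , d≤k , i+d<m , inj₁ (a , b)) = i , d , d≤k , i+d<m , inj₂ (a , b)
  covers-sym (i , d , d≤k , i+d<m , inj₂ (a , b)) = i , d , d≤k , i+d<m , inj₁ (a , b)

  covers-extend : ∀ {k s m m' x y} → m ≤ m' → Covers k s m x y → Covers k s m' x y
  covers-extend m≤m' (i , d , d≤k , i+d<m , r) = i , d , d≤k , <-≤-trans i+d<m m≤m' , r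

  transport-pair : ∀ {a b c d x y : ℕ} → a ≡ c → b ≡ d →
    (a ≡ x × b ≡ y) ⊎ (a ≡ y × b ≡ x) → (c ≡ x × d ≡ y) ⊎ (c ≡ y × d ≡ x)
  transport-pair refl refl r = r

  covers-cong : ∀ {k s t m x y} → (∀ i → i < m → s i ≡ t i) → Covers k s m x y → Covers k t m x y
  covers-cong s≗t (i , d , d≤k , i+d<m , r) =
    i , d , d≤k , i+d<m , transport-pair (s≗t i (≤-<-trans (m≤m+n i d) i+d<m)) (s≗t (i + d) i+d<m) r

  concat : ℕ → (ℕ → ℕ) → (ℕ → ℕ) → ℕ → ℕ
  concat m₁ s₁ s₂ i = if i <ᵇ m₁ then s₁ i else s₂ (i ∸ m₁)

  concat-left : ∀ m₁ s₁ s₂ i → i < m₁ → concat m₁ s₁ s₂ i ≡ s₁ i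
  concat-left m₁ s₁ s₂ i i<m₁ with i <ᵇ m₁ | <⇒<ᵇ i<m₁
  ... | true | _ = refl

  concat-right : ∀ m₁ s₁ s₂ i → concat m₁ s₁ s₂ (m₁ + i) ≡ s₂ i
  concat-right m₁ s₁ s₂ i with (m₁ + i) <ᵇ m₁ | <ᵇ⇒< (m₁ + i) m₁
  ... | false | _ = cong s₂ (m+n∸m≡n m₁ i)
  ... | true | lt = ⊥-elim (<⇒≱ (lt _) (m≤m+n m₁ i))

  covers-concatˡ : ∀ {k s₁ s₂ m₁ m₂ x y} → Covers k s₁ m₁ x y → Covers k (concat m₁ s₁ s₂) (m₁ + m₂) x y
  covers-concatˡ {s₁ = s₁} {s₂} {m₁} {m₂} c =
    covers-extend (m≤m+n m₁ m₂) (covers-cong (λ i i<m₁ → sym (concat-left m₁ s₁ s₂ i i<m₁)) c)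

  covers-concatʳ : ∀ {k s₁ s₂ m₁ m₂ x y} → Covers k s₂ m₂ x y → Covers k (concat m₁ s₁ s₂) (m₁ + m₂) x y
  covers-concatʳ {s₁ = s₁} {s₂} {m₁} {m₂} (i , d , d≤k , i+d<m₂ , r) =
    m₁ + i , d , d≤k , shifted , transport-pair (sym (concat-right m₁ s₁ s₂ i)) at-end r
    where
    shifted : m₁ + i + d < m₁ + m₂
    shifted = subst (_< m₁ + m₂) (sym (+-assoc m₁ i d)) (+-monoʳ-< m₁ i+d<m₂)
    at-end : s₂ (i + d) ≡ concat m₁ s₁ s₂ (m₁ + i + d)
    at-end = sym (trans (cong (concat m₁ s₁ s₂) (+-assoc m₁ i d)) (concat-right m₁ s₁ s₂ (i + d)))

  blocks : (L : ℕ) → .{{_ : NonZero L}} → (ℕ → ℕ → ℕ) → ℕ → ℕ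
  blocks L w p = w (p / L) (p % L)

  blocks-at : ∀ L .{{_ : NonZero L}} w g i → i < L → blocks L w (i + g * L) ≡ w g i
  blocks-at L w g i i<L = cong₂ w (+*-/-digit L g i i<L) (+*-%-digit L g i i<L)

  covers-in-block : ∀ {k} L .{{_ : NonZero L}} w G g i d {x y} → g < G → i + d < L → d ≤ k →
    w g i ≡ x → w g (i + d) ≡ y → Covers k (blocks L w) (G * L) x y
  covers-in-block L w G g i d {x} {y} g<G i+d<L d≤k wx wy =
    i + g * L , d , d≤k , in-range , inj₁ (first , second)
    where
    swap : i + g * L + d ≡ (i + d) + g * L
    swap = trans (+-assoc i (g * L) d) (trans (cong (i +_) (+-comm (g * L) d)) (sym (+-assoc i d (g * L))))
    in-range : i + g * L + d < G * L
    in-range = subst (_< G * L) (sym swap) (<-≤-trans (+-monoˡ-< (g * L) i+d<L) (*-monoˡ-≤ L g<G))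
    first : blocks L w (i + g * L) ≡ x
    first = trans (blocks-at L w g i (≤-<-trans (m≤m+n i d) i+d<L)) wx
    second : blocks L w (i + g * L + d) ≡ y
    second = trans (cong (blocks L w) swap) (trans (blocks-at L w g (i + d) i+d<L) wy)

module BlowUp where

  open import Data.Nat
  open import Data.Nat.Properties
  open import Data.Nat.DivMod
  open import Data.Nat.Divisibility using (_∣_)
  open import Data.Product using (Σ; _×_; _,_; proj₁; proj₂)
  open import Data.Sum using (inj₁; inj₂)
  open import Relation.Nullary using (yes; no)
  open import Relation.Binary using (tri<; tri≈; tri>)
  open import Relation.Binary.PropositionalEquality
  open ≡-Reasoning
  open ModularArithmetic
  open Covering

  width : ℕ → ℕ
  width k = suc (k + k)

  -- From a k-radius sequence on B = b + 1 letters to one on width k · B letters.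
  -- The letter u + y·B (u < B, y < width k) is read as "u in column y".
  module Step (k b : ℕ) (divisible : ∀ j → 1 ≤ j → j ≤ k → j ∣ b) where

    B C L : ℕ
    B = suc b
    C = width k
    L = suc (b + k)

    crossWord : ℕ → ℕ → ℕ
    crossWord g i = ((g % B) + T i) % B + ((g / B + i) % C) * B

    cross : ℕ → ℕ
    cross = blocks L crossWord

    crossLength : ℕ
    crossLength = C * B * L

    crossWord-decode : ∀ gu gy i → gu < B → crossWord (gu + gy * B) i ≡ (gu + T i) % B + ((gy + i) % C) * B
    crossWord-decode gu gy i gu<B rewrite +*-%-digit B gy gu gu<B | +*-/-digit B gy gu gu<B = refl

    -- For residues pu, qu and a step 1 ≤ j ≤ k there is an offset a < B such that every
    -- block showing pu at offset a shows qu at offset a + j: since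
    -- T (a + j) = T a + j·a + T j, this amounts to solving j·a ≡ qu - pu - T j (mod B).
    solve-offset : ∀ pu qu j → 1 ≤ j → j ≤ k → qu < B →
      Σ ℕ λ a → a < B × (∀ gu → (gu + T a) % B ≡ pu % B → (gu + T (a + j)) % B ≡ qu)
    solve-offset pu qu j 1≤j j≤k qu<B = a , m%n<n (proj₁ inverse * R) B , shows-qu
      where
      inverse = invertible-mod 1≤j (divisible j 1≤j j≤k)
      R a : ℕ
      R = minus-mod B qu (pu + T j)
      a = (proj₁ inverse * R) % B
      j*a≡R : (j * a) % B ≡ R % B
      j*a≡R = trans (%-absorb-*ʳ B j (proj₁ inverse * R)) (proj₂ inverse R)
      shows-qu : ∀ gu → (gu + T a) % B ≡ pu % B → (gu + T (a + j)) % B ≡ qu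
      shows-qu gu start = begin
        (gu + T (a + j)) % B              ≡⟨ cong (λ z → (gu + z) % B) (T-+ a j) ⟩
        (gu + (T a + (j * a + T j))) % B  ≡⟨ cong (_% B) (+-assoc gu (T a) _) ⟨
        (gu + T a + (j * a + T j)) % B    ≡⟨ %-cong-+ B (gu + T a) pu _ start ⟩
        (pu + (j * a + T j)) % B          ≡⟨ cong (_% B) (+-assoc pu (j * a) (T j)) ⟨
        (pu + j * a + T j) % B            ≡⟨ cong (λ z → (z + T j) % B) (+-comm pu (j * a)) ⟩
        (j * a + pu + T j) % B            ≡⟨ cong (_% B) (+-assoc (j * a) pu (T j)) ⟩
        (j * a + (pu + T j)) % B          ≡⟨ %-cong-+ B (j * a) R _ j*a≡R ⟩
        (R + (pu + T j)) % B              ≡⟨ minus-mod-spec B qu (pu + T j) ⟩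
        qu % B                            ≡⟨ m<n⇒m%n≡m qu<B ⟩
        qu                                ∎

    cross-covers-step : ∀ pu py qu qy j → pu < B → qu < B → py < C → 1 ≤ j → j ≤ k →
      (py + j) % C ≡ qy → Covers k cross crossLength (pu + py * B) (qu + qy * B)
    cross-covers-step pu py qu qy j pu<B qu<B py<C 1≤j j≤k column =
      covers-in-block L crossWord (C * B) g a j g<CB (+-mono-<-≤ a<B j≤k) j≤k first second
      where
      offset = solve-offset pu qu j 1≤j j≤k qu<B
      a gu gy g : ℕ
      a = proj₁ offset
      a<B = proj₁ (proj₂ offset)
      gu = minus-mod B pu (T a)
      gy = minus-mod C py a
      g = gu + gy * B
      gu<B = minus-mod-< B pu (T a)
      g<CB : g < C * B
      g<CB = <-≤-trans (+-monoˡ-< (gy * B) gu<B) (*-monoˡ-≤ B (minus-mod-< C py a))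
      letter : ℕ → ℕ → ℕ
      letter u y = u + y * B
      first : crossWord g a ≡ pu + py * B
      first = begin
        crossWord g a                        ≡⟨ crossWord-decode gu gy a gu<B ⟩
        (gu + T a) % B + ((gy + a) % C) * B  ≡⟨ cong₂ letter (minus-mod-spec B pu (T a)) (minus-mod-spec C py a) ⟩
        pu % B + (py % C) * B                ≡⟨ cong₂ letter (m<n⇒m%n≡m pu<B) (m<n⇒m%n≡m py<C) ⟩
        pu + py * B                          ∎
      second-column : (gy + (a + j)) % C ≡ qy
      second-column = begin
        (gy + (a + j)) % C  ≡⟨ cong (_% C) (+-assoc gy a j) ⟨
        (gy + a + j) % C    ≡⟨ %-cong-+ C (gy + a) py j (minus-mod-spec C py a) ⟩
        (py + j) % C        ≡⟨ column ⟩
        qy                  ∎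
      second : crossWord g (a + j) ≡ qu + qy * B
      second = begin
        crossWord g (a + j)                              ≡⟨ crossWord-decode gu gy (a + j) gu<B ⟩
        (gu + T (a + j)) % B + ((gy + (a + j)) % C) * B  ≡⟨ cong₂ letter (proj₂ (proj₂ offset) gu (minus-mod-spec B pu (T a))) second-column ⟩
        qu + qy * B                                      ∎

    -- Letters in two different columns py < py + δ < C are covered: the cyclic distance
    -- between the columns is δ or C - δ, and one of the two is at most k.
    cross-covers : ∀ pu py qu δ → pu < B → qu < B → 1 ≤ δ → py + δ < C →
      Covers k cross crossLength (pu + py * B) (qu + (py + δ) * B)
    cross-covers pu py qu δ pu<B qu<B 1≤δ py+δ<C with δ ≤? k
    ... | yes δ≤k = cross-covers-step pu py qu (py + δ) δ pu<B qu<B py<C 1≤δ δ≤k (m<n⇒m%n≡m py+δ<C)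
      where py<C = ≤-<-trans (m≤m+n py δ) py+δ<C
    ... | no δ≰k = covers-sym (cross-covers-step qu (py + δ) pu py (C ∸ δ) qu<B pu<B py+δ<C 1≤C∸δ C∸δ≤k wraps)
      where
      δ<C : δ < C
      δ<C = ≤-<-trans (m≤n+m δ py) py+δ<C
      1≤C∸δ : 1 ≤ C ∸ δ
      1≤C∸δ = m<n⇒0<n∸m δ<C
      C∸δ≤k : C ∸ δ ≤ k
      C∸δ≤k = ≤-trans (∸-monoʳ-≤ C (≰⇒> δ≰k)) (≤-reflexive (m+n∸n≡m k k))
      wraps : (py + δ + (C ∸ δ)) % C ≡ py
      wraps = begin
        (py + δ + (C ∸ δ)) % C    ≡⟨ cong (_% C) (+-assoc py δ (C ∸ δ)) ⟩
        (py + (δ + (C ∸ δ))) % C  ≡⟨ cong (λ z → (py + z) % C) (m+[n∸m]≡n (<⇒≤ δ<C)) ⟩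
        (py + C) % C              ≡⟨ [m+n]%n≡m%n py C ⟩
        py % C                    ≡⟨ m<n⇒m%n≡m (≤-<-trans (m≤m+n py δ) py+δ<C) ⟩
        py                        ∎

    columnWord : (ℕ → ℕ) → ℕ → ℕ → ℕ
    columnWord t y i = t i + y * B

    columns-cover : ∀ mB t → IsRadiusSeq k B mB t → ∀ u u' y → u < B → u' < B → y < C →
      Covers k (blocks (suc mB) (columnWord t)) (C * suc mB) (u + y * B) (u' + y * B)
    columns-cover mB t t-radius u u' y u<B u'<B y<C with t-radius u u' u<B u'<B
    ... | i , d , d≤k , i+d<mB , inj₁ (tu , tu') =
      covers-in-block (suc mB) (columnWord t) C y i d y<C (m≤n⇒m≤1+n i+d<mB) d≤k
        (cong (_+ y * B) tu) (cong (_+ y * B) tu')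
    ... | i , d , d≤k , i+d<mB , inj₂ (tu' , tu) = covers-sym
      (covers-in-block (suc mB) (columnWord t) C y i d y<C (m≤n⇒m≤1+n i+d<mB) d≤k
        (cong (_+ y * B) tu') (cong (_+ y * B) tu))

    blowUp : (ℕ → ℕ) → ℕ → ℕ → ℕ
    blowUp t mB = concat crossLength cross (blocks (suc mB) (columnWord t))

    blowUpLength : ℕ → ℕ
    blowUpLength mB = crossLength + C * suc mB

    blowUp-radius : ∀ mB t → IsRadiusSeq k B mB t → IsRadiusSeq k (C * B) (blowUpLength mB) (blowUp t mB)
    blowUp-radius mB t t-radius x y x<CB y<CB =
      subst₂ (Covers k (blowUp t mB) (blowUpLength mB)) (sym (m≡m%n+[m/n]*n x B)) (sym (m≡m%n+[m/n]*n y B))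
        (by-columns (x % B) (x / B) (y % B) (y / B) (m%n<n x B) (m%n<n y B) (m<n*o⇒m/o<n x<CB) (m<n*o⇒m/o<n y<CB))
      where
      columnsPart = blocks (suc mB) (columnWord t)
      crossPart : ∀ {p q} → Covers k cross crossLength p q → Covers k (blowUp t mB) (blowUpLength mB) p q
      crossPart = covers-concatˡ {s₂ = columnsPart} {m₂ = C * suc mB}
      by-columns : ∀ pu py qu qy → pu < B → qu < B → py < C → qy < C →
        Covers k (blowUp t mB) (blowUpLength mB) (pu + py * B) (qu + qy * B)
      by-columns pu py qu qy pu<B qu<B py<C qy<C with <-cmp py qy
      ... | tri≈ _ refl _ =
        covers-concatʳ {s₁ = cross} {m₁ = crossLength} (columns-cover mB t t-radius pu qu py pu<B qu<B py<C)
      ... | tri< py<qy _ _ = crossPart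
        (subst (λ z → Covers k cross crossLength (pu + py * B) (qu + z * B)) (m+[n∸m]≡n (<⇒≤ py<qy))
          (cross-covers pu py qu (qy ∸ py) pu<B qu<B (m<n⇒0<n∸m py<qy)
            (subst (_< C) (sym (m+[n∸m]≡n (<⇒≤ py<qy))) qy<C)))
      ... | tri> _ _ qy<py = covers-sym (crossPart
        (subst (λ z → Covers k cross crossLength (qu + qy * B) (pu + z * B)) (m+[n∸m]≡n (<⇒≤ qy<py))
          (cross-covers qu qy pu (py ∸ qy) qu<B pu<B (m<n⇒0<n∸m qy<py)
            (subst (_< C) (sym (m+[n∸m]≡n (<⇒≤ qy<py))) py<C))))

module UpperBound where

  open import Data.Nat
  open import Data.Nat.Properties
  open import Data.Nat.DivMod
  open import Data.Nat.Divisibility using (_∣_; ∣-trans; m∣m*n; m≤n⇒m!∣n!)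
  open import Data.Product using (Σ; _×_; _,_; proj₁; proj₂)
  open import Data.Nat.Tactic.RingSolver using (solve-∀)
  open import Relation.Binary.PropositionalEquality
  open ModularArithmetic using (+*-%-digit; +*-/-digit)
  open Covering
  open BlowUp

  -- Every 1 ≤ j ≤ k divides k!·r, since j ∣ j! ∣ k!.
  divides-factorial-multiple : ∀ k r j → 1 ≤ j → j ≤ k → j ∣ k ! * r
  divides-factorial-multiple k r (suc j') _ j≤k =
    ∣-trans (∣-trans (m∣m*n (j' !)) (m≤n⇒m!∣n! j≤k)) (m∣m*n r)

  radius-mono : ∀ {k n n' m s} → n ≤ n' → IsRadiusSeq k n' m s → IsRadiusSeq k n m s
  radius-mono n≤n' s-radius x y x<n y<n = s-radius x y (<-≤-trans x<n n≤n') (<-≤-trans y<n n≤n')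

  -- The trivial radius sequence: the two-letter words x y for all pairs, length 2n².
  pairWord : ℕ → ℕ → ℕ → ℕ
  pairWord n g zero = g / suc n
  pairWord n g (suc _) = g % suc n

  trivial : ∀ k n → 1 ≤ k → Σ (ℕ → ℕ) λ s → IsRadiusSeq k n (n * n * 2) s
  trivial k zero _ = (λ _ → 0) , λ x y ()
  trivial k (suc n) 1≤k = blocks 2 (pairWord n) , covered
    where
    covered : IsRadiusSeq k (suc n) (suc n * suc n * 2) (blocks 2 (pairWord n))
    covered x y x<n y<n =
      covers-in-block 2 (pairWord n) (suc n * suc n) (y + x * suc n) 0 1 pair<n² (s≤s (s≤s z≤n)) 1≤k
        (+*-/-digit (suc n) x y y<n) (+*-%-digit (suc n) x y y<n)
      where
      pair<n² : y + x * suc n < suc n * suc n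
      pair<n² = <-≤-trans (+-monoˡ-< (x * suc n) y<n) (*-monoˡ-≤ (suc n) x<n)

  -- Level L of the upper bound: a constant c such that every alphabet size n has a
  -- k-radius sequence of length m with 2k·m·C^L ≤ (C^L + 4k)(n + c)², C = 2k + 1;
  -- that is, m ≤ (1 + 4k / C^L) (n + c)² / 2k.
  UpperBoundAt : ℕ → ℕ → Set
  UpperBoundAt k L = Σ ℕ λ c → ∀ n → Σ ℕ λ m → Σ (ℕ → ℕ) λ s →
    IsRadiusSeq k n m s × 2 * k * m * width k ^ L ≤ (width k ^ L + 4 * k) * ((n + c) * (n + c))

  upper-base : ∀ k → 1 ≤ k → UpperBoundAt k 0
  upper-base k 1≤k = 0 , λ n → n * n * 2 , proj₁ (trivial k n 1≤k) , proj₂ (trivial k n 1≤k) , bound n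
    where
    bound : ∀ n → 2 * k * (n * n * 2) * 1 ≤ (1 + 4 * k) * ((n + 0) * (n + 0))
    bound n = subst₂ _≤_ (sym (lhs k n)) (sym (rhs k n)) (m≤n+m (4 * k * (n * n)) (n * n))
      where
      lhs : ∀ k n → 2 * k * (n * n * 2) * 1 ≡ 4 * k * (n * n)
      lhs = solve-∀
      rhs : ∀ k n → (1 + 4 * k) * ((n + 0) * (n + 0)) ≡ n * n + 4 * k * (n * n)
      rhs = solve-∀

  square-mono : ∀ {x y} → x ≤ y → x * x ≤ y * y
  square-mono x≤y = *-mono-≤ x≤y x≤y

  blowUp-length-bound : ∀ k b mB R c X → 1 ≤ k →
    2 * k * mB * R ≤ (R + 4 * k) * ((suc b + c) * (suc b + c)) →
    width k * suc b + k * width k ≤ X → width k * suc b + width k * c ≤ X →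
    2 * k * (width k * suc b * suc (b + k) + width k * suc mB) * (width k * R)
      ≤ (width k * R + 4 * k) * (X * X)
  blowUp-length-bound k b mB R c X 1≤k inner X₁ X₂ = begin
    2 * k * (C * suc b * suc (b + k) + C * suc mB) * (C * R)
      ≡⟨ expand k C b mB R ⟩
    2 * k * R * (n' * (n' + k * C) + C * C) + C * C * (2 * k * mB * R)
      ≤⟨ +-mono-≤ (*-monoʳ-≤ (2 * k * R) cross-part) (*-monoʳ-≤ (C * C) inner) ⟩
    2 * k * R * ((n' + k * C) * (n' + k * C)) + C * C * ((R + 4 * k) * ((suc b + c) * (suc b + c)))
      ≡⟨ cong (2 * k * R * ((n' + k * C) * (n' + k * C)) +_) (scale C R k (suc b) c) ⟩
    2 * k * R * ((n' + k * C) * (n' + k * C)) + (R + 4 * k) * ((n' + C * c) * (n' + C * c))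
      ≤⟨ +-mono-≤ (*-monoʳ-≤ (2 * k * R) (square-mono X₁)) (*-monoʳ-≤ (R + 4 * k) (square-mono X₂)) ⟩
    2 * k * R * (X * X) + (R + 4 * k) * (X * X)
      ≡⟨ collect k R X ⟩
    (C * R + 4 * k) * (X * X) ∎
    where
    open ≤-Reasoning
    C n' : ℕ
    C = width k
    n' = C * suc b
    expand : ∀ k C b mB R → 2 * k * (C * suc b * suc (b + k) + C * suc mB) * (C * R) ≡
      2 * k * R * (C * suc b * (C * suc b + k * C) + C * C) + C * C * (2 * k * mB * R)
    expand = solve-∀
    scale : ∀ C R k B c → C * C * ((R + 4 * k) * ((B + c) * (B + c))) ≡ (R + 4 * k) * ((C * B + C * c) * (C * B + C * c))
    scale = solve-∀
    collect : ∀ k R X → 2 * k * R * (X * X) + (R + 4 * k) * (X * X) ≡ (suc (k + k) * R + 4 * k) * (X * X)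
    collect = solve-∀
    square-split : ∀ a b → (a + b) * (a + b) ≡ a * (a + b) + b * (a + b)
    square-split = solve-∀
    C≤kC : C ≤ k * C
    C≤kC = subst (_≤ k * C) (*-identityˡ C) (*-monoˡ-≤ C 1≤k)
    cross-part : n' * (n' + k * C) + C * C ≤ (n' + k * C) * (n' + k * C)
    cross-part = subst (n' * (n' + k * C) + C * C ≤_) (sym (square-split n' (k * C)))
      (+-monoʳ-≤ (n' * (n' + k * C)) (≤-trans (square-mono C≤kC) (*-monoʳ-≤ (k * C) (m≤n+m (k * C) n'))))

  -- Choice of the inner alphabet for a target size n: with D = C·k! put
  -- b = k!·(n/D + 1); then every j ≤ k divides b and n ≤ C·(b + 1) ≤ n + (D + C).
  module InnerAlphabet (k n : ℕ) where

    C D : ℕ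
    C = width k
    D = C * k !

    instance
      D-nonZero : NonZero D
      D-nonZero = m*n≢0 C (k !) {{_}} {{k !≢0}}

    b : ℕ
    b = k ! * suc (n / D)

    divisible : ∀ j → 1 ≤ j → j ≤ k → j ∣ b
    divisible = divides-factorial-multiple k (suc (n / D))

    at-least-n : n ≤ C * suc b
    at-least-n = <⇒≤ (<-≤-trans n<[t+1]D (≤-trans (≤-reflexive (sym (reorder C (k !) (n / D))))
                                                   (*-monoʳ-≤ C (n≤1+n b))))
      where
      n<[t+1]D : n < suc (n / D) * D
      n<[t+1]D = subst (_< suc (n / D) * D) (sym (m≡m%n+[m/n]*n n D)) (+-monoˡ-< (n / D * D) (m%n<n n D))
      reorder : ∀ C K t → C * (K * suc t) ≡ suc t * (C * K)
      reorder = solve-∀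

    at-most-n+D+C : C * suc b ≤ n + (D + C)
    at-most-n+D+C = subst (_≤ n + (D + C)) (sym (expand C (k !) (n / D))) (+-monoˡ-≤ (D + C) (m/n*n≤m n D))
      where
      expand : ∀ C K t → C * suc (K * suc t) ≡ t * (C * K) + (C * K + C)
      expand = solve-∀

  upper-step : ∀ k L → 1 ≤ k → UpperBoundAt k L → UpperBoundAt k (suc L)
  upper-step k L 1≤k (c , inner) = c' , outer
    where
    C E c' : ℕ
    C = width k
    E = C * k ! + C
    c' = E + k * C + C * c
    outer : ∀ n → Σ ℕ λ m → Σ (ℕ → ℕ) λ s → IsRadiusSeq k n m s ×
      2 * k * m * (C * C ^ L) ≤ (C * C ^ L + 4 * k) * ((n + c') * (n + c'))
    outer n = S.blowUpLength mB , S.blowUp t mB , radius-mono at-least-n (S.blowUp-radius mB t t-radius) ,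
              blowUp-length-bound k b mB (C ^ L) c (n + c') 1≤k t-bound X₁ X₂
      where
      open InnerAlphabet k n using (b; divisible; at-least-n; at-most-n+D+C)
      module S = Step k b divisible
      mB : ℕ
      mB = proj₁ (inner (suc b))
      t : ℕ → ℕ
      t = proj₁ (proj₂ (inner (suc b)))
      t-radius : IsRadiusSeq k (suc b) mB t
      t-radius = proj₁ (proj₂ (proj₂ (inner (suc b))))
      t-bound : 2 * k * mB * C ^ L ≤ (C ^ L + 4 * k) * ((suc b + c) * (suc b + c))
      t-bound = proj₂ (proj₂ (proj₂ (inner (suc b))))
      X₁ : C * suc b + k * C ≤ n + c'
      X₁ = ≤-trans (+-monoˡ-≤ (k * C) at-most-n+D+C)
             (≤-trans (≤-reflexive (+-assoc n E (k * C))) (+-monoʳ-≤ n (m≤m+n (E + k * C) (C * c))))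
      X₂ : C * suc b + C * c ≤ n + c'
      X₂ = ≤-trans (+-monoˡ-≤ (C * c) at-most-n+D+C)
             (≤-trans (≤-reflexive (+-assoc n E (C * c))) (+-monoʳ-≤ n (+-monoˡ-≤ (C * c) (m≤m+n E (k * C)))))

  upper-bound : ∀ k L → 1 ≤ k → UpperBoundAt k L
  upper-bound k zero 1≤k = upper-base k 1≤k
  upper-bound k (suc L) 1≤k = upper-step k L 1≤k (upper-bound k L 1≤k)

module LowerBound where

  open import Data.Nat
  open import Data.Nat.Properties
  open import Data.Product using (_×_; _,_; proj₁; proj₂)
  open import Relation.Nullary using (yes; no; ¬_)
  open import Relation.Binary using (tri<; tri≈; tri>)
  open import Relation.Binary.PropositionalEquality
  open import Data.Empty using (⊥-elim)
  open import Data.Fin using (Fin; toℕ; fromℕ<; punchIn; combine; remQuot)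
  open import Data.Fin.Properties
    using (toℕ-fromℕ<; toℕ-injective; punchIn-injective; punchInᵢ≢i; combine-injective; combine-remQuot; injective⇒≤)
  open import Data.List using (List; length; lookup)
  open import Defs using (IsKRadius)

  -- A position j ≠ i with |i - j| ≤ k is determined by i and one of 2k offset codes:
  -- j - i - 1 when j lies to the right of i, k + (i - j - 1) when it lies to the left.
  offsetCode : ℕ → ℕ → ℕ → ℕ
  offsetCode k i j with <-cmp i j
  ... | tri< _ _ _ = j ∸ suc i
  ... | tri≈ _ _ _ = 0
  ... | tri> _ _ _ = k + (i ∸ suc j)

  displace : ℕ → ℕ → ℕ → ℕ
  displace k i o with o <? k
  ... | yes _ = i + suc o
  ... | no _ = i ∸ suc (o ∸ k)

  offsetCode-correct : ∀ k i j → ¬ i ≡ j → ∣ i - j ∣ ≤ k →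
    offsetCode k i j < k + k × displace k i (offsetCode k i j) ≡ j
  offsetCode-correct k i j i≢j i~j with <-cmp i j
  ... | tri≈ _ i≡j _ = ⊥-elim (i≢j i≡j)
  ... | tri< i<j _ _ = <-≤-trans d<k (m≤m+n k k) , back
    where
    d : ℕ
    d = j ∸ suc i
    j≡ : suc i + d ≡ j
    j≡ = m+[n∸m]≡n i<j
    distance : ∣ i - j ∣ ≡ suc d
    distance = trans (cong (λ z → ∣ i - z ∣) (trans (sym j≡) (sym (+-suc i d)))) (∣m-m+n∣≡n i (suc d))
    d<k : d < k
    d<k = subst (_≤ k) distance i~j
    back : displace k i d ≡ j
    back with d <? k
    ... | yes _ = trans (+-suc i d) j≡
    ... | no d≮k = ⊥-elim (d≮k d<k)
  ... | tri> _ _ j<i = +-monoʳ-< k d<k , back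
    where
    d : ℕ
    d = i ∸ suc j
    i≡ : suc j + d ≡ i
    i≡ = m+[n∸m]≡n j<i
    distance : ∣ i - j ∣ ≡ suc d
    distance = trans (∣-∣-comm i j) (trans (cong (λ z → ∣ j - z ∣) (trans (sym i≡) (sym (+-suc j d)))) (∣m-m+n∣≡n j (suc d)))
    d<k : d < k
    d<k = subst (_≤ k) distance i~j
    back : displace k i (k + d) ≡ j
    back with (k + d) <? k
    ... | yes k+d<k = ⊥-elim (<⇒≱ k+d<k (m≤m+n k d))
    ... | no _ = trans (cong (λ z → i ∸ suc z) (m+n∸m≡n k d))
                   (trans (cong (_∸ suc d) (trans (sym i≡) (sym (+-suc j d)))) (m+n∸n≡m j (suc d)))

  -- Counting argument: in a k-radius sequence a over n₀ + 1 letters, each ordered pair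
  -- (x, z) with z ≠ x (z = punchIn x z') is witnessed by an occurrence i of x and
  -- the offset code of a nearby occurrence of z; this pair (i, code) determines (x, z').
  module PairCode (k n₀ : ℕ) (a : List (Fin (suc n₀))) (radius : IsKRadius k (suc n₀) a) where

    m : ℕ
    m = length a

    here there : Fin (suc n₀) → Fin n₀ → Fin m
    here x z = proj₁ (radius x (punchIn x z))
    there x z = proj₁ (proj₂ (radius x (punchIn x z)))

    at-here : ∀ x z → lookup a (here x z) ≡ x
    at-here x z = proj₁ (proj₂ (proj₂ (radius x (punchIn x z))))

    at-there : ∀ x z → lookup a (there x z) ≡ punchIn x z
    at-there x z = proj₁ (proj₂ (proj₂ (proj₂ (radius x (punchIn x z)))))

    close : ∀ x z → ∣ toℕ (here x z) - toℕ (there x z) ∣ ≤ k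
    close x z = proj₂ (proj₂ (proj₂ (proj₂ (radius x (punchIn x z)))))

    distinct : ∀ x z → ¬ toℕ (here x z) ≡ toℕ (there x z)
    distinct x z e = punchInᵢ≢i x z
      (trans (sym (at-there x z)) (trans (cong (lookup a) (sym (toℕ-injective e))) (at-here x z)))

    code-correct : ∀ x z →
      offsetCode k (toℕ (here x z)) (toℕ (there x z)) < k + k ×
      displace k (toℕ (here x z)) (offsetCode k (toℕ (here x z)) (toℕ (there x z))) ≡ toℕ (there x z)
    code-correct x z = offsetCode-correct k (toℕ (here x z)) (toℕ (there x z)) (distinct x z) (close x z)

    code : Fin (suc n₀) → Fin n₀ → Fin (k + k)
    code x z = fromℕ< (proj₁ (code-correct x z))

    pairCode : Fin (suc n₀) × Fin n₀ → Fin (m * (k + k))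
    pairCode (x , z) = combine (here x z) (code x z)

    pairCode-injective : ∀ p q → pairCode p ≡ pairCode q → p ≡ q
    pairCode-injective (x , z) (x' , z') eq = same-pair same-x same-partner
      where
      parts = combine-injective (here x z) (code x z) (here x' z') (code x' z') eq
      same-code : offsetCode k (toℕ (here x z)) (toℕ (there x z)) ≡ offsetCode k (toℕ (here x' z')) (toℕ (there x' z'))
      same-code = trans (sym (toℕ-fromℕ< (proj₁ (code-correct x z))))
                    (trans (cong toℕ (proj₂ parts)) (toℕ-fromℕ< (proj₁ (code-correct x' z'))))
      same-there : toℕ (there x z) ≡ toℕ (there x' z')
      same-there = trans (sym (proj₂ (code-correct x z)))
                     (trans (cong₂ (displace k) (cong toℕ (proj₁ parts)) same-code) (proj₂ (code-correct x' z')))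
      same-x : x ≡ x'
      same-x = trans (sym (at-here x z)) (trans (cong (lookup a) (proj₁ parts)) (at-here x' z'))
      same-partner : punchIn x z ≡ punchIn x' z'
      same-partner = trans (sym (at-there x z)) (trans (cong (lookup a) (toℕ-injective same-there)) (at-there x' z'))
      same-pair : x ≡ x' → punchIn x z ≡ punchIn x' z' → (x , z) ≡ (x' , z')
      same-pair refl p = cong (x ,_) (punchIn-injective x z z' p)

  lower-bound : ∀ k n₀ (a : List (Fin (suc n₀))) → IsKRadius k (suc n₀) a → suc n₀ * n₀ ≤ length a * (k + k)
  lower-bound k n₀ a radius = injective⇒≤ {f = λ u → pairCode (remQuot n₀ u)} λ {u} {v} e →
    trans (sym (combine-remQuot {suc n₀} n₀ u))
      (trans (cong (λ p → combine (proj₁ p) (proj₂ p)) (pairCode-injective _ _ e)) (combine-remQuot {suc n₀} n₀ v))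
    where open PairCode k n₀ a radius

module RationalBounds where

  open import Data.Nat as ℕ using (ℕ; zero; suc; _≤_)
  import Data.Nat.Properties as ℕ
  open import Data.Integer as ℤ using (+_; -[1+_]; +<+)
  import Data.Integer.Properties as ℤ
  open import Data.Rational as ℚ using (ℚ; mkℚ; 0ℚ; ∣_∣; _-_; toℚᵘ; ↧ₙ_)
  import Data.Rational.Properties as ℚ
  import Data.Rational.Unnormalised as ℚᵘ
  import Data.Rational.Unnormalised.Properties as ℚᵘ
  open import Relation.Binary.PropositionalEquality
  open import Defs using (ratio)

  numerator-difference : ∀ A K P → P ≤ A ℕ.* K → (+ A) ℤ.* (+ K) ℤ.+ (ℤ.- (+ 1)) ℤ.* (+ P) ≡ + (A ℕ.* K ℕ.∸ P)
  numerator-difference A K P P≤AK = begin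
    (+ A) ℤ.* (+ K) ℤ.+ (ℤ.- (+ 1)) ℤ.* (+ P)  ≡⟨ cong₂ ℤ._+_ (sym (ℤ.pos-* A K)) (ℤ.-1*i≡-i (+ P)) ⟩
    + (A ℕ.* K) ℤ.+ ℤ.- (+ P)                  ≡⟨ ℤ.m-n≡m⊖n (A ℕ.* K) P ⟩
    (A ℕ.* K) ℤ.⊖ P                            ≡⟨ ℤ.⊖-≥ P≤AK ⟩
    + (A ℕ.* K ℕ.∸ P)                          ∎
    where open ≡-Reasoning

  difference-small : ∀ A K P T e → P ≤ K ℕ.* A → T ℕ.* (K ℕ.* A) ℕ.< (T ℕ.+ K) ℕ.* P →
    (A ℕ.* K ℕ.∸ P) ℕ.* T ℕ.< suc e ℕ.* (P ℕ.* K)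
  difference-small A K P T e P≤KA hyp =
    ℕ.≤-trans (subst (ℕ._< K ℕ.* P) (sym distribute) cancelled)
      (ℕ.≤-trans (ℕ.≤-reflexive (ℕ.*-comm K P)) (ℕ.m≤m+n (P ℕ.* K) (e ℕ.* (P ℕ.* K))))
    where
    TP≤TKA : T ℕ.* P ≤ T ℕ.* (K ℕ.* A)
    TP≤TKA = ℕ.*-monoʳ-≤ T P≤KA
    distribute : (A ℕ.* K ℕ.∸ P) ℕ.* T ≡ T ℕ.* (K ℕ.* A) ℕ.∸ T ℕ.* P
    distribute = trans (ℕ.*-distribʳ-∸ T (A ℕ.* K) P)
      (cong₂ ℕ._∸_ (trans (ℕ.*-comm (A ℕ.* K) T) (cong (T ℕ.*_) (ℕ.*-comm A K))) (ℕ.*-comm P T))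
    cancelled : T ℕ.* (K ℕ.* A) ℕ.∸ T ℕ.* P ℕ.< K ℕ.* P
    cancelled = ℕ.+-cancelʳ-< (T ℕ.* P) _ (K ℕ.* P)
      (subst₂ ℕ._<_ (sym (ℕ.m∸n+n≡m TP≤TKA)) (trans (ℕ.*-distribʳ-+ P T K) (ℕ.+-comm (T ℕ.* P) (K ℕ.* P))) hyp)

  -- Let T be the denominator of ε > 0.  If P ≤ K·A and T·(K·A) < (T + K)·P, then
  -- 0 ≤ A/P - 1/K = (A·K - P)/(P·K) < 1/T ≤ ε.
  close-to-reciprocal : ∀ A P K (ε : ℚ) → 0ℚ ℚ.< ε → 1 ≤ P → 1 ≤ K → P ≤ K ℕ.* A →
    ↧ₙ ε ℕ.* (K ℕ.* A) ℕ.< (↧ₙ ε ℕ.+ K) ℕ.* P → ∣ ratio A P - ratio 1 K ∣ ℚ.< ε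
  close-to-reciprocal A P K (mkℚ (+ zero) d _) (ℚ.*<* (+<+ ())) _ _ _ _
  close-to-reciprocal A P K (mkℚ -[1+ n ] d _) (ℚ.*<* ()) _ _ _ _
  close-to-reciprocal A (suc P') (suc K') ε@(mkℚ (+ suc e) d _) _ _ _ P≤KA hyp =
    ℚ.toℚᵘ-cancel-< (ℚᵘ.<-respˡ-≃ (ℚᵘ.≃-sym as-unnormalised) unnormalised)
    where
    P K : ℕ
    P = suc P'
    K = suc K'
    A/P = ℚᵘ.mkℚᵘ (+ A) P'
    1/K = ℚᵘ.mkℚᵘ (+ 1) K'
    as-unnormalised : toℚᵘ (∣ ratio A P - ratio 1 K ∣) ℚᵘ.≃ ℚᵘ.∣ A/P ℚᵘ.- 1/K ∣
    as-unnormalised = ℚᵘ.≃-trans (ℚ.toℚᵘ-homo-∣-∣ (ratio A P - ratio 1 K))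
      (ℚᵘ.∣-∣-cong (ℚᵘ.≃-trans (ℚ.toℚᵘ-homo-+ (ratio A P) (ℚ.- ratio 1 K))
        (ℚᵘ.+-cong (ℚ.toℚᵘ-fromℚᵘ A/P)
          (ℚᵘ.≃-trans (ℚ.toℚᵘ-homo‿- (ratio 1 K)) (ℚᵘ.-‿cong (ℚ.toℚᵘ-fromℚᵘ 1/K))))))
    unnormalised : ℚᵘ.∣ A/P ℚᵘ.- 1/K ∣ ℚᵘ.< toℚᵘ ε
    unnormalised = ℚᵘ.*<*
      (subst (λ z → (+ ℤ.∣ z ∣) ℤ.* (+ suc d) ℤ.< (+ suc e) ℤ.* (+ (P ℕ.* K)))
        (sym (numerator-difference A K P (subst (P ≤_) (ℕ.*-comm K A) P≤KA)))
        (subst₂ ℤ._<_ (ℤ.pos-* (A ℕ.* K ℕ.∸ P) (suc d)) (ℤ.pos-* (suc e) (P ℕ.* K))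
          (+<+ (difference-small A K P (suc d) e P≤KA hyp))))

module Asymptotics where

  open import Data.Nat
  open import Data.Nat.Properties
  open import Data.Nat.DivMod using (_%_; m%n<n; m<n⇒m%n≡m)
  open import Data.Nat.Combinatorics using (_C_; nC1≡n; nCk+nC[k+1]≡[n+1]C[k+1])
  open import Data.Product using (Σ; _×_; _,_; proj₁; proj₂)
  open import Data.Sum using (_⊎_; inj₁; inj₂)
  open import Data.List using (List; []; _∷_; length; lookup)
  open import Data.Fin using (Fin; toℕ; fromℕ<) renaming (zero to fzero; suc to fsuc)
  open import Data.Fin.Properties using (toℕ-fromℕ<; toℕ-injective; toℕ<n)
  open import Data.Nat.Tactic.RingSolver using (solve-∀)
  open import Relation.Binary.PropositionalEquality
  open import Defs using (IsKRadius; IsShortestKRadiusLength)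
  open Covering using (IsRadiusSeq)
  open LowerBound using (lower-bound)

  -- The first m entries of s, read as letters of Fin n; a radius sequence becomes a
  -- k-radius sequence in the sense of the paper.
  letter : ∀ {n₀} → ℕ → Fin (suc n₀)
  letter {n₀} x = fromℕ< (m%n<n x (suc n₀))

  letter-toℕ : ∀ {n₀} (x : Fin (suc n₀)) v → v ≡ toℕ x → letter v ≡ x
  letter-toℕ {n₀} x v v≡x = toℕ-injective
    (trans (toℕ-fromℕ< (m%n<n v (suc n₀))) (trans (cong (_% suc n₀) v≡x) (m<n⇒m%n≡m (toℕ<n x))))

  prefix : ∀ {n₀} → ℕ → (ℕ → ℕ) → List (Fin (suc n₀))
  prefix zero s = []
  prefix (suc m) s = letter (s 0) ∷ prefix m (λ i → s (suc i))

  length-prefix : ∀ {n₀} m s → length (prefix {n₀} m s) ≡ m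
  length-prefix zero s = refl
  length-prefix (suc m) s = cong suc (length-prefix m (λ i → s (suc i)))

  prefix-at : ∀ {n₀} m s i → i < m →
    Σ (Fin (length (prefix {n₀} m s))) λ p → toℕ p ≡ i × lookup (prefix m s) p ≡ letter (s i)
  prefix-at (suc m) s zero _ = fzero , refl , refl
  prefix-at (suc m) s (suc i) (s≤s i<m) with prefix-at m (λ j → s (suc j)) i i<m
  ... | p , p≡i , at-p = fsuc p , cong suc p≡i , at-p

  prefix-radius : ∀ k n₀ m s → IsRadiusSeq k (suc n₀) m s → IsKRadius k (suc n₀) (prefix m s)
  prefix-radius k n₀ m s s-radius x y with s-radius (toℕ x) (toℕ y) (toℕ<n x) (toℕ<n y)
  ... | i , d , d≤k , i+d<m , order = in-order order
    where
    first = prefix-at {n₀} m s i (≤-<-trans (m≤m+n i d) i+d<m)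
    second = prefix-at {n₀} m s (i + d) i+d<m
    p = proj₁ first
    q = proj₁ second
    distance : ∣ toℕ p - toℕ q ∣ ≡ d
    distance = trans (cong₂ ∣_-_∣ (proj₁ (proj₂ first)) (proj₁ (proj₂ second))) (∣m-m+n∣≡n i d)
    in-order : (s i ≡ toℕ x × s (i + d) ≡ toℕ y) ⊎ (s i ≡ toℕ y × s (i + d) ≡ toℕ x) →
      Σ (Fin (length (prefix m s))) λ i' → Σ (Fin (length (prefix m s))) λ j' →
        (lookup (prefix m s) i' ≡ x) × (lookup (prefix m s) j' ≡ y) × (∣ toℕ i' - toℕ j' ∣ ≤ k)
    in-order (inj₁ (sx , sy)) = p , q ,
      trans (proj₂ (proj₂ first)) (letter-toℕ x (s i) sx) ,
      trans (proj₂ (proj₂ second)) (letter-toℕ y (s (i + d)) sy) ,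
      subst (_≤ k) (sym distance) d≤k
    in-order (inj₂ (sy , sx)) = q , p ,
      trans (proj₂ (proj₂ second)) (letter-toℕ x (s (i + d)) sx) ,
      trans (proj₂ (proj₂ first)) (letter-toℕ y (s i) sy) ,
      subst (_≤ k) (sym (trans (∣-∣-comm (toℕ q) (toℕ p)) distance)) d≤k

  shortest-≤ : ∀ {k n m m' s} → IsShortestKRadiusLength k n m → IsRadiusSeq k n m' s → m ≤ m'
  shortest-≤ {n = zero} (_ , minimal) _ = ≤-trans (minimal [] λ ()) z≤n
  shortest-≤ {k} {suc n₀} {m} {m'} {s} (_ , minimal) s-radius =
    subst (m ≤_) (length-prefix m' s) (minimal (prefix m' s) (prefix-radius k n₀ m' s s-radius))

  choose-two : ∀ n → 2 * (suc n C 2) ≡ suc n * n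
  choose-two zero = refl
  choose-two (suc n) = begin
    2 * (suc (suc n) C 2)        ≡⟨ cong (2 *_) (nCk+nC[k+1]≡[n+1]C[k+1] (suc n) 1) ⟨
    2 * (suc n C 1 + suc n C 2)  ≡⟨ cong (λ z → 2 * (z + suc n C 2)) (nC1≡n (suc n)) ⟩
    2 * (suc n + suc n C 2)      ≡⟨ *-distribˡ-+ 2 (suc n) (suc n C 2) ⟩
    2 * suc n + 2 * (suc n C 2)  ≡⟨ cong (2 * suc n +_) (choose-two n) ⟩
    2 * suc n + suc n * n        ≡⟨ regroup n ⟩
    suc (suc n) * suc n          ∎
    where
    open ≡-Reasoning
    regroup : ∀ n → 2 * suc n + suc n * n ≡ suc (suc n) * suc n
    regroup = solve-∀

  choose-two-positive : ∀ n₀ → 1 ≤ n₀ → 1 ≤ suc n₀ C 2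
  choose-two-positive (suc n₀) _ with suc (suc n₀) C 2 | choose-two (suc n₀)
  ... | suc _ | _ = s≤s z≤n

  choose-two-≤-shortest : ∀ {k n₀ m} → IsShortestKRadiusLength k (suc n₀) m → suc n₀ C 2 ≤ k * m
  choose-two-≤-shortest {k} {n₀} {m} ((a , a-radius , length-a) , _) =
    *-cancelˡ-≤ 2 (subst₂ _≤_ (sym (choose-two n₀)) (double m k) counted)
    where
    counted : suc n₀ * n₀ ≤ m * (k + k)
    counted = subst (λ z → suc n₀ * n₀ ≤ z * (k + k)) length-a (lower-bound k n₀ a a-radius)
    double : ∀ m k → m * (k + k) ≡ 2 * (k * m)
    double = solve-∀

  exponent-< : ∀ Z → 2 ≤ Z → ∀ L → L < Z ^ L
  exponent-< Z 2≤Z zero = s≤s z≤n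
  exponent-< Z 2≤Z (suc L) = begin-strict
    suc L              ≤⟨ exponent-< Z 2≤Z L ⟩
    Z ^ L              <⟨ m<m+n (Z ^ L) (<-≤-trans (s≤s z≤n) (exponent-< Z 2≤Z L)) ⟩
    Z ^ L + Z ^ L      ≡⟨ cong (Z ^ L +_) (+-identityʳ (Z ^ L)) ⟨
    2 * Z ^ L          ≤⟨ *-monoˡ-≤ (Z ^ L) 2≤Z ⟩
    Z * Z ^ L          ∎
    where open ≤-Reasoning

  -- A quadratic with leading coefficient a is eventually beaten by (a + K)·n·(n - 1):
  -- a·(n + c)² < (a + K)·n·(n - 1) once n - 1 > 2ac + ac² + a.
  square-dominated : ∀ a K c n₀ → 1 ≤ K → 2 * a * c + a * c * c + a < n₀ →
    a * ((suc n₀ + c) * (suc n₀ + c)) < (a + K) * (suc n₀ * n₀)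
  square-dominated a K c n₀ 1≤K large = subst₂ _<_ (sym (split-square a c n₀)) (sym (split-sum a K n₀))
    (+-monoʳ-< (a * (n * n₀)) lower-order)
    where
    n M : ℕ
    n = suc n₀
    M = 2 * a * c + a * c * c + a
    split-square : ∀ a c n₀ → a * ((suc n₀ + c) * (suc n₀ + c)) ≡
      a * (suc n₀ * n₀) + (a * suc n₀ + 2 * a * c * suc n₀ + a * c * c)
    split-square = solve-∀
    split-sum : ∀ a K n₀ → (a + K) * (suc n₀ * n₀) ≡ a * (suc n₀ * n₀) + K * (suc n₀ * n₀)
    split-sum = solve-∀
    factor : ∀ a c n → a * n + 2 * a * c * n + n * (a * c * c) ≡ n * (2 * a * c + a * c * c + a)
    factor = solve-∀
    lower-order : a * n + 2 * a * c * n + a * c * c < K * (n * n₀)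
    lower-order = begin-strict
      a * n + 2 * a * c * n + a * c * c      ≤⟨ +-monoʳ-≤ (a * n + 2 * a * c * n) (m≤n*m (a * c * c) n) ⟩
      a * n + 2 * a * c * n + n * (a * c * c) ≡⟨ factor a c n ⟩
      n * M                                   <⟨ *-monoʳ-< n large ⟩
      n * n₀                                  ≡⟨ *-identityˡ (n * n₀) ⟨
      1 * (n * n₀)                            ≤⟨ *-monoˡ-≤ (n * n₀) 1≤K ⟩
      K * (n * n₀)                            ∎
      where open ≤-Reasoning

  squeeze : ∀ K T R A m X P → 1 ≤ T → 8 * T ≤ R → A ≤ m →
    2 * K * m * R ≤ (R + 4 * K) * (X * X) →
    (2 * T + K) * (X * X) < (2 * T + K + K) * (2 * P) →
    T * (K * A) < (T + K) * P
  squeeze K T R A m X P 1≤T 8T≤R A≤m length-bound dominated = *-cancelˡ-< (4 * R) _ _ (begin-strict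
    4 * R * (T * (K * A))            ≡⟨ regroup R T K A ⟩
    2 * T * (2 * K * A * R)          ≤⟨ *-monoʳ-≤ (2 * T) (*-monoˡ-≤ R (*-monoʳ-≤ (2 * K) A≤m)) ⟩
    2 * T * (2 * K * m * R)          ≤⟨ *-monoʳ-≤ (2 * T) length-bound ⟩
    2 * T * ((R + 4 * K) * (X * X))  ≤⟨ small-correction ⟩
    R * ((2 * T + K) * (X * X))      <⟨ *-monoʳ-< R dominated ⟩
    R * ((2 * T + K + K) * (2 * P))  ≡⟨ collect R T K P ⟩
    4 * R * ((T + K) * P)            ∎)
    where
    open ≤-Reasoning
    instance
      R-nonZero : NonZero R
      R-nonZero = >-nonZero (≤-trans (≤-trans 1≤T (m≤n*m T 8)) 8T≤R)
    regroup : ∀ R T K A → 4 * R * (T * (K * A)) ≡ 2 * T * (2 * K * A * R)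
    regroup = solve-∀
    collect : ∀ R T K P → R * ((2 * T + K + K) * (2 * P)) ≡ 4 * R * ((T + K) * P)
    collect = solve-∀
    expand-left : ∀ T R K Y → 2 * T * ((R + 4 * K) * Y) ≡ (2 * T * R + K * (8 * T)) * Y
    expand-left = solve-∀
    expand-right : ∀ T R K Y → R * ((2 * T + K) * Y) ≡ (2 * T * R + K * R) * Y
    expand-right = solve-∀
    -- the error term 8T·K·X² is absorbed into K·R·X²
    small-correction : 2 * T * ((R + 4 * K) * (X * X)) ≤ R * ((2 * T + K) * (X * X))
    small-correction = subst₂ _≤_ (sym (expand-left T R K (X * X))) (sym (expand-right T R K (X * X)))
      (*-monoˡ-≤ (X * X) (+-monoʳ-≤ (2 * T * R) (*-monoʳ-≤ K 8T≤R)))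

open import Defs
open import Data.Nat using (ℕ; _≤_; _≥_)
open import Data.Nat.Combinatorics using (_C_)
open import Data.Rational using (ℚ; 0ℚ; _<_; _-_; ∣_∣)
open import Data.Product using (Σ)

open import Data.Nat as ℕ using (suc; s≤s; z≤n; _+_; _*_; _^_)
import Data.Nat.Properties as ℕ
open import Data.Rational using (↧ₙ_)
open import Data.Product using (_,_; proj₁; proj₂)
open import Relation.Binary.PropositionalEquality using (subst; sym)
open BlowUp using (width)
open UpperBound using (UpperBoundAt; upper-bound)
open RationalBounds using (close-to-reciprocal)
open Asymptotics
open Covering using (IsRadiusSeq)

-- Let T be the denominator of ε and R = (2k + 1)^(8T) ≥ 8T.  Level 8T of the upper
-- bound gives c with 2k·f_k(n)·R ≤ (R + 4k)(n + c)², the lower bound gives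
-- C(n, 2) ≤ k·f_k(n), and for n beyond N the two squeeze f_k(n)/C(n, 2) into
-- the interval [1/k, 1/k + 1/T).
theorem1 : (k : ℕ) → 1 ≤ k → (f : ℕ → ℕ) →
    ((n : ℕ) → IsShortestKRadiusLength k n (f n)) →
    (ε : ℚ) → 0ℚ < ε →
    Σ ℕ (λ N → (n : ℕ) → n ≥ N → ∣ ratio (f n) (n C 2) - ratio 1 k ∣ < ε)
theorem1 k 1≤k f shortest ε 0<ε = N , close
  where
  T R a c N : ℕ
  T = ↧ₙ ε
  R = width k ^ (8 * T)
  a = 2 * T + k
  level : UpperBoundAt k (8 * T)
  level = upper-bound k (8 * T) 1≤k
  c = proj₁ level
  N = suc (suc (2 * a * c + a * c * c + a))
  8T≤R : 8 * T ≤ R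
  8T≤R = ℕ.<⇒≤ (exponent-< (width k) (s≤s (ℕ.≤-trans 1≤k (ℕ.m≤m+n k k))) (8 * T))
  close : (n : ℕ) → n ≥ N → ∣ ratio (f n) (n C 2) - ratio 1 k ∣ < ε
  close (suc n₀) (s≤s N≤n) =
    close-to-reciprocal (f n) (n C 2) k ε 0<ε (choose-two-positive n₀ (ℕ.≤-trans (s≤s z≤n) N≤n)) 1≤k
      (choose-two-≤-shortest (shortest n))
      (squeeze k T R (f n) m (n + c) (n C 2) (s≤s z≤n) 8T≤R (shortest-≤ (shortest n) m-radius) m-bound
        (subst (λ z → a * ((n + c) * (n + c)) ℕ.< (a + k) * z) (sym (choose-two n₀))
          (square-dominated a k c n₀ 1≤k N≤n)))
    where
    n m : ℕ
    n = suc n₀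
    m = proj₁ (proj₂ level n)
    m-radius : IsRadiusSeq k n m (proj₁ (proj₂ (proj₂ level n)))
    m-radius = proj₁ (proj₂ (proj₂ (proj₂ level n)))
    m-bound : 2 * k * m * R ≤ (R + 4 * k) * ((n + c) * (n + c))
    m-bound = proj₂ (proj₂ (proj₂ (proj₂ level n)))
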